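{- Let $p$ be an odd prime such that $r=(p-1)/2$ is prime. If $14$ nontrivially flanks $2p$ at distance $1$, then $p \equiv 3 \pmod{8}$.
   Context: For integers $k\ge 0$ and $n\ge 1$, $\sigma_k(n)=\sum_{d\mid n} d^k$ and $\phi(n)$ is Euler's totient function. For each $k\geq 0$, $S_k$ denotes the set of composite positive integers $n$ satisfying $n\cdot\sigma_k(n)\equiv 2 \pmod{\phi(n)}$. For $k\ge 1$, $14$ flanks $n$ at distance $1$ at $k$ if $n\in S_k$, $14\in S_{k-1}$ and $14\in S_{k+1}$; "$14$ nontrivially flanks $n$ at distance $1$" means this holds for some $k\ge 1$. -}

module Defs where

open import Data.Nat using (ℕ; zero; suc; _+_; _*_; _^_; _<_)
open import Data.Nat.Divisibility using (_∣_; _∣?_)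
open import Data.Nat.GCD using (gcd)
open import Data.Nat.Primality using (Composite)
open import Data.Nat.Properties using (_≟_)
open import Data.List using (List; filter; upTo; map; length)
open import Data.Nat.ListAction using (sum)
open import Data.Product using (_×_; Σ)
open import Data.Integer as ℤ using (ℤ; +_)
open import Data.Integer.Divisibility as ℤD using ()
open import Relation.Nullary.Decidable using (Dec)

divisors : ℕ → List ℕ
divisors n = filter (λ d → d ∣? n) (map suc (upTo n))

σ : ℕ → ℕ → ℕ
σ k n = sum (map (λ d → d ^ k) (divisors n))

φ : ℕ → ℕ
φ n = length (filter (λ m → gcd m n ≟ 1) (map suc (upTo n)))

infix 4 _≋_[mod_]
_≋_[mod_] : ℕ → ℕ → ℕ → Set
a ≋ b [mod m ] = (+ m) ℤD.∣ ((+ a) ℤ.- (+ b))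

S : ℕ → ℕ → Set
S k n = Composite n × (n * σ k n ≋ 2 [mod φ n ])

Flanks14 : ℕ → ℕ → Set
Flanks14 k n = S k n × (S (k Data.Nat.∸ 1) 14 × S (suc k) 14)

NontriviallyFlanks14 : ℕ → Set
NontriviallyFlanks14 n = Σ ℕ (λ k → (1 Data.Nat.≤ k) × Flanks14 k n)

{-# OPTIONS --safe #-}

-- Let 14 flank 2p at k. Since φ(14) = 6 and σ_j(14) = (2^j + 1)(7^j + 1) is divisible by 3
-- for odd j, 14 ∈ S_(k+1) forces k to be odd. The divisors of 2p are 1, 2, p, 2p, so
-- σ_k(2p) = (2^k + 1)(p^k + 1), and φ(2p) = p − 1 = 2r. For r = 2 we would need
-- 10·σ_k(10) ≡ 2 modulo φ(10) = 4, but 4 divides 10·σ_k(10) when k is odd.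
-- For odd r, reducing 2p·σ_k(2p) ≡ 2 (mod 2r) modulo r, where p ≡ 1, gives r ∣ x² + 1
-- with x = 2^((k+1)/2). If r ≡ 3 (mod 4), then (r − 1)/2 is odd, so x² + 1 divides
-- x^(r−1) + 1, while x^(r−1) ≡ 1 by Fermat's little theorem for the base 2; hence r ∣ 2,
-- which is absurd. So r ≡ 1 (mod 4), that is p ≡ 3 (mod 8).

module Submission where

open import Defs
open import Data.Nat.Base
open import Data.Nat.Properties
open import Data.Nat.Divisibility
open import Data.Nat.DivMod
open import Data.Nat.GCD using (gcd)
open import Data.Nat.Primality
open import Data.Nat.Coprimality as Coprimality
  using (Coprime; coprime-divisor; prime⇒coprime; coprime⇒gcd≡1; gcd≡1⇒coprime)
open import Data.Nat.Combinatorics using (_C_; nCn≡1; nCk≡n!/k![n-k]!; k![n∸k]!∣n!)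
open import Data.Nat.ListAction as List using ()
open import Data.Nat.Tactic.RingSolver using (solve-∀)
import Data.Integer.Base as ℤ
import Data.Integer.Properties as ℤ
open import Data.Fin.Base using (Fin; zero; suc; toℕ; inject₁; fromℕ)
open import Data.Fin.Properties using (toℕ-inject₁; toℕ-fromℕ; toℕ<n)
open import Data.List.Base using (List; []; _∷_; [_]; _++_; map; filter; upTo; length)
open import Data.List.Properties
  using (upTo-∷ʳ; map-++; filter-++; filter-accept; filter-reject; ++-identityʳ; length-++)
open import Data.Product using (_×_; ∃-syntax; _,_; proj₁; proj₂)
open import Data.Sum using (_⊎_; inj₁; inj₂)
open import Data.Empty using (⊥-elim)
open import Function.Base using (_∘_; _∘′_)
open import Relation.Nullary using (¬_; contradiction)
open import Relation.Unary using (Decidable)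
open import Relation.Binary.PropositionalEquality hiding ([_])
open import Relation.Binary.Bundles using (Setoid)
open import Relation.Binary.Structures using (IsEquivalence)
open import Level using (0ℓ)
import Relation.Binary.Reasoning.Setoid as SetoidReasoning
open import Algebra.Properties.Monoid.Sum +-0-monoid using (sum; sum-init-last; sum-cong-≗)
import Algebra.Definitions.RawSemiring +-*-rawSemiring as Semiring

even⊎odd : ∀ n → (∃[ h ] n ≡ 2 * h) ⊎ (∃[ h ] n ≡ suc (2 * h))
even⊎odd zero = inj₁ (0 , refl)
even⊎odd (suc n) with even⊎odd n
... | inj₁ (h , n≡2h)  = inj₂ (h , cong suc n≡2h)
... | inj₂ (h , n≡1+2h) = inj₁ (suc h , trans (cong suc n≡1+2h) (sym (*-suc 2 h)))

¬2∣odd : ∀ h → ¬ 2 ∣ suc (2 * h)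
¬2∣odd h (divides q 1+2h≡q*2) = even≢odd q h (trans (*-comm 2 q) (sym 1+2h≡q*2))

^-distribʳ-* : ∀ m n o → (m * n) ^ o ≡ m ^ o * n ^ o
^-distribʳ-* m n zero    = refl
^-distribʳ-* m n (suc o) = trans (cong (m * n *_) (^-distribʳ-* m n o)) (*-*-interchange m n (m ^ o) (n ^ o))
  where
  *-*-interchange : ∀ a b c d → a * b * (c * d) ≡ a * c * (b * d)
  *-*-interchange = solve-∀

m+1∣m^odd+1 : ∀ m h → m + 1 ∣ m ^ suc (2 * h) + 1
m+1∣m^odd+1 m zero    = ∣-reflexive (cong (_+ 1) (sym (*-identityʳ m)))
m+1∣m^odd+1 m (suc h) = ∣m+n∣m⇒∣n (subst (m + 1 ∣_) (sym split) m+1∣rhs) (m∣m*n m)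
  where
  m+1∣rhs : m + 1 ∣ m * m * (m ^ suc (2 * h) + 1) + (m + 1)
  m+1∣rhs = ∣m∣n⇒∣m+n (∣n⇒∣m*n (m * m) (m+1∣m^odd+1 m h)) ∣-refl
  split : (m + 1) * m + (m ^ suc (2 * suc h) + 1) ≡ m * m * (m ^ suc (2 * h) + 1) + (m + 1)
  split = begin
    (m + 1) * m + (m ^ suc (2 * suc h) + 1)       ≡⟨ cong (λ e → (m + 1) * m + (m ^ suc e + 1)) (*-suc 2 h) ⟩
    (m + 1) * m + (m * (m * m ^ suc (2 * h)) + 1) ≡⟨ identity m (m ^ suc (2 * h)) ⟩
    m * m * (m ^ suc (2 * h) + 1) + (m + 1)       ∎
    where
    open ≡-Reasoning
    identity : ∀ m x → (m + 1) * m + (m * (m * x) + 1) ≡ m * m * (x + 1) + (m + 1)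
    identity = solve-∀

m∣n∧m<n⇒2*m≤n : ∀ {m n} → m ∣ n → m < n → 2 * m ≤ n
m∣n∧m<n⇒2*m≤n {m} {n} m∣n m<n = begin
  2 * m               ≤⟨ *-monoˡ-≤ m (quotient>1 m∣n m<n) ⟩
  quotient m∣n * m    ≡⟨ m∣n⇒n≡quotient*m m∣n ⟨
  n                   ∎
  where open ≤-Reasoning

m∣n∧n<2*m⇒n≡m : ∀ {m n} .{{_ : NonZero n}} → m ∣ n → n < 2 * m → n ≡ m
m∣n∧n<2*m⇒n≡m m∣n n<2m with m≤n⇒m<n∨m≡n (∣⇒≤ m∣n)
... | inj₁ m<n = contradiction (m∣n∧m<n⇒2*m≤n m∣n m<n) (<⇒≱ n<2m)
... | inj₂ m≡n = sym m≡n

coprime-*ʳ : ∀ {a b c} → Coprime a b → Coprime a c → Coprime a (b * c)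
coprime-*ʳ a⊥b a⊥c (i∣a , i∣bc) = a⊥c (i∣a , coprime-divisor (λ (j∣i , j∣b) → a⊥b (∣-trans j∣i i∣a , j∣b)) i∣bc)

¬∣⇒coprime : ∀ {p n} → Prime p → ¬ p ∣ n → Coprime n p
¬∣⇒coprime pr p∤n (i∣n , i∣p) with prime⇒irreducible pr i∣p
... | inj₁ i≡1  = i≡1
... | inj₂ refl = contradiction i∣n p∤n

prime⇒≡2⊎≡1+4q⊎≡3+4q : ∀ {r} → Prime r → r ≡ 2 ⊎ (∃[ q ] r ≡ 1 + 4 * q) ⊎ (∃[ q ] r ≡ 3 + 4 * q)
prime⇒≡2⊎≡1+4q⊎≡3+4q {r} pr with even⊎odd r
... | inj₁ (h , r≡2h) with prime⇒irreducible pr (divides h (trans r≡2h (*-comm 2 h)))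
...   | inj₁ ()
...   | inj₂ 2≡r = inj₁ (sym 2≡r)
prime⇒≡2⊎≡1+4q⊎≡3+4q {r} pr | inj₂ (h , r≡1+2h) with even⊎odd h
...   | inj₁ (q , refl) = inj₂ (inj₁ (q , trans r≡1+2h (cong suc (sym (*-assoc 2 2 q)))))
...   | inj₂ (q , refl) = inj₂ (inj₂ (q , trans r≡1+2h (identity q)))
  where
  identity : ∀ q → suc (2 * suc (2 * q)) ≡ 3 + 4 * q
  identity = solve-∀

∣m⊖n∣≡∣m-n∣ : ∀ m n → ℤ.∣ m ℤ.⊖ n ∣ ≡ ∣ m - n ∣
∣m⊖n∣≡∣m-n∣ m n with ≤-total m n
... | inj₁ m≤n = trans (ℤ.∣⊖∣-≤ m≤n) (sym (trans (∣-∣-comm m n) (m≤n⇒∣n-m∣≡n∸m m≤n)))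
... | inj₂ n≤m = trans (ℤ.∣m⊖n∣≡∣n⊖m∣ m n) (trans (ℤ.∣⊖∣-≤ n≤m) (sym (m≤n⇒∣n-m∣≡n∸m n≤m)))

-- A record rather than the bare equation of remainders, so that a, b and m can be
-- inferred from the type.
infix 4 _≡_[mod_]
record _≡_[mod_] (a b m : ℕ) .{{_ : NonZero m}} : Set where
  constructor mod
  field %-≡ : a % m ≡ b % m
open _≡_[mod_]

module _ {m} .{{_ : NonZero m}} where

  ≡[mod]-isEquivalence : IsEquivalence (_≡_[mod m ])
  ≡[mod]-isEquivalence = record
    { refl  = mod refl
    ; sym   = λ a≡b → mod (sym (%-≡ a≡b))
    ; trans = λ a≡b b≡c → mod (trans (%-≡ a≡b) (%-≡ b≡c))
    }

  ≡[mod]-setoid : Setoid 0ℓ 0ℓ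
  ≡[mod]-setoid = record { isEquivalence = ≡[mod]-isEquivalence }

  open IsEquivalence ≡[mod]-isEquivalence public
    using () renaming (refl to ≡[mod]-refl; sym to ≡[mod]-sym; trans to ≡[mod]-trans)

  ≡[mod]-+ : ∀ {a b c d} → a ≡ b [mod m ] → c ≡ d [mod m ] → a + c ≡ b + d [mod m ]
  ≡[mod]-+ {a} {b} {c} {d} (mod a≡b) (mod c≡d) = mod (begin
    (a + c) % m             ≡⟨ %-distribˡ-+ a c m ⟩
    (a % m + c % m) % m     ≡⟨ cong₂ (λ x y → (x + y) % m) a≡b c≡d ⟩
    (b % m + d % m) % m     ≡⟨ %-distribˡ-+ b d m ⟨
    (b + d) % m             ∎)
    where open ≡-Reasoning

  ≡[mod]-* : ∀ {a b c d} → a ≡ b [mod m ] → c ≡ d [mod m ] → a * c ≡ b * d [mod m ]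
  ≡[mod]-* {a} {b} {c} {d} (mod a≡b) (mod c≡d) = mod (begin
    (a * c) % m             ≡⟨ %-distribˡ-* a c m ⟩
    (a % m * (c % m)) % m   ≡⟨ cong₂ (λ x y → (x * y) % m) a≡b c≡d ⟩
    (b % m * (d % m)) % m   ≡⟨ %-distribˡ-* b d m ⟨
    (b * d) % m             ∎)
    where open ≡-Reasoning

  ≡[mod]-+-congʳ : ∀ {a b} c → a ≡ b [mod m ] → a + c ≡ b + c [mod m ]
  ≡[mod]-+-congʳ c a≡b = ≡[mod]-+ a≡b (≡[mod]-refl {c})

  ≡[mod]-*-congˡ : ∀ c {a b} → a ≡ b [mod m ] → c * a ≡ c * b [mod m ]
  ≡[mod]-*-congˡ c a≡b = ≡[mod]-* (≡[mod]-refl {c}) a≡b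

  ≡[mod]-^ : ∀ {a b} → a ≡ b [mod m ] → ∀ n → a ^ n ≡ b ^ n [mod m ]
  ≡[mod]-^ a≡b zero    = ≡[mod]-refl
  ≡[mod]-^ a≡b (suc n) = ≡[mod]-* a≡b (≡[mod]-^ a≡b n)

  ∸-∣⇒≡[mod] : ∀ {a b} → a ≤ b → m ∣ b ∸ a → a ≡ b [mod m ]
  ∸-∣⇒≡[mod] {a} {b} a≤b (divides q b∸a≡qm) = mod (begin
    a % m                   ≡⟨ [m+kn]%n≡m%n a q m ⟨
    (a + q * m) % m         ≡⟨ cong (λ x → (a + x) % m) b∸a≡qm ⟨
    (a + (b ∸ a)) % m       ≡⟨ cong (_% m) (m+[n∸m]≡n a≤b) ⟩
    b % m                   ∎)
    where open ≡-Reasoning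

  ≡[mod]⇒∸-∣ : ∀ {a b} → a ≤ b → a ≡ b [mod m ] → m ∣ b ∸ a
  ≡[mod]⇒∸-∣ {a} {b} a≤b (mod a≡b) = divides (b / m ∸ a / m) (begin
    b ∸ a                                       ≡⟨ cong₂ _∸_ (m≡m%n+[m/n]*n b m) (m≡m%n+[m/n]*n a m) ⟩
    (b % m + b / m * m) ∸ (a % m + a / m * m)   ≡⟨ cong (λ x → (b % m + b / m * m) ∸ (x + a / m * m)) a≡b ⟩
    (b % m + b / m * m) ∸ (b % m + a / m * m)   ≡⟨ [m+n]∸[m+o]≡n∸o (b % m) _ _ ⟩
    b / m * m ∸ a / m * m                       ≡⟨ *-distribʳ-∸ m (b / m) (a / m) ⟨
    (b / m ∸ a / m) * m                         ∎)
    where open ≡-Reasoning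

  ∣-∣-∣⇒≡[mod] : ∀ {a b} → m ∣ ∣ a - b ∣ → a ≡ b [mod m ]
  ∣-∣-∣⇒≡[mod] {a} {b} m∣∣a-b∣ with ≤-total a b
  ... | inj₁ a≤b = ∸-∣⇒≡[mod] a≤b (subst (m ∣_) (trans (∣-∣-comm a b) (m≤n⇒∣n-m∣≡n∸m a≤b)) m∣∣a-b∣)
  ... | inj₂ b≤a = ≡[mod]-sym (∸-∣⇒≡[mod] b≤a (subst (m ∣_) (m≤n⇒∣n-m∣≡n∸m b≤a) m∣∣a-b∣))

  ≡[mod]⇒∣-∣-∣ : ∀ {a b} → a ≡ b [mod m ] → m ∣ ∣ a - b ∣
  ≡[mod]⇒∣-∣-∣ {a} {b} a≡b with ≤-total a b
  ... | inj₁ a≤b = subst (m ∣_) (trans (sym (m≤n⇒∣n-m∣≡n∸m a≤b)) (∣-∣-comm b a)) (≡[mod]⇒∸-∣ a≤b a≡b)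
  ... | inj₂ b≤a = subst (m ∣_) (sym (m≤n⇒∣n-m∣≡n∸m b≤a)) (≡[mod]⇒∸-∣ b≤a (≡[mod]-sym a≡b))

  ∣⇒≡0[mod] : ∀ {a} → m ∣ a → a ≡ 0 [mod m ]
  ∣⇒≡0[mod] {a} m∣a = ∣-∣-∣⇒≡[mod] (subst (m ∣_) (sym (∣-∣-identityʳ a)) m∣a)

  ≡0[mod]⇒∣ : ∀ {a} → a ≡ 0 [mod m ] → m ∣ a
  ≡0[mod]⇒∣ {a} a≡0 = subst (m ∣_) (∣-∣-identityʳ a) (≡[mod]⇒∣-∣-∣ a≡0)

  ≡[mod]-+-cancelʳ : ∀ {a b} c → a + c ≡ b + c [mod m ] → a ≡ b [mod m ]
  ≡[mod]-+-cancelʳ {a} {b} c a+c≡b+c = ∣-∣-∣⇒≡[mod] (subst (m ∣_) ∣a+c-b+c∣≡∣a-b∣ (≡[mod]⇒∣-∣-∣ a+c≡b+c))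
    where
    ∣a+c-b+c∣≡∣a-b∣ : ∣ a + c - b + c ∣ ≡ ∣ a - b ∣
    ∣a+c-b+c∣≡∣a-b∣ = trans (cong₂ ∣_-_∣ (+-comm a c) (+-comm b c)) (∣m+n-m+o∣≡∣n-o∣ c a b)

  ≡[mod]-*-cancelˡ : ∀ {a b} c → Coprime m c → c * a ≡ c * b [mod m ] → a ≡ b [mod m ]
  ≡[mod]-*-cancelˡ {a} {b} c m⊥c ca≡cb =
    ∣-∣-∣⇒≡[mod] (coprime-divisor m⊥c (subst (m ∣_) (sym (*-distribˡ-∣-∣ c a b)) (≡[mod]⇒∣-∣-∣ ca≡cb)))

  ≋⇒≡[mod] : ∀ {a b} → a ≋ b [mod m ] → a ≡ b [mod m ]
  ≋⇒≡[mod] {a} {b} a≋b = ∣-∣-∣⇒≡[mod] (subst (m ∣_) ∣+a-+b∣≡∣a-b∣ a≋b)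
    where
    ∣+a-+b∣≡∣a-b∣ : ℤ.∣ ℤ.+ a ℤ.- ℤ.+ b ∣ ≡ ∣ a - b ∣
    ∣+a-+b∣≡∣a-b∣ = trans (cong ℤ.∣_∣ (ℤ.m-n≡m⊖n a b)) (∣m⊖n∣≡∣m-n∣ a b)

module ≡[mod]-Reasoning (m : ℕ) .{{_ : NonZero m}} = SetoidReasoning (≡[mod]-setoid {m})

≡[mod]-divisor : ∀ {d m a b} .{{_ : NonZero d}} .{{_ : NonZero m}} → d ∣ m → a ≡ b [mod m ] → a ≡ b [mod d ]
≡[mod]-divisor {d} {m} {a} {b} d∣m (mod a≡b) = mod (begin
  a % d         ≡⟨ m∣n⇒o%n%m≡o%m d m a d∣m ⟨
  a % m % d     ≡⟨ cong (_% d) a≡b ⟩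
  b % m % d     ≡⟨ m∣n⇒o%n%m≡o%m d m b d∣m ⟩
  b % d         ∎)
  where open ≡-Reasoning

prime∤! : ∀ {p n} → Prime p → n < p → ¬ p ∣ n !
prime∤! {p} {zero} pr _ p∣1 = nonTrivial⇒≢1 {{prime⇒nonTrivial pr}} (∣1⇒≡1 p∣1)
prime∤! {p} {suc n} pr n<p p∣ with euclidsLemma (suc n) (n !) pr p∣
... | inj₁ p∣n = <⇒≱ n<p (∣⇒≤ p∣n)
... | inj₂ p∣n! = prime∤! pr (<-trans (n<1+n n) n<p) p∣n!

nCk*[k!*[n∸k]!]≡n! : ∀ {n k} → k ≤ n → (n C k) * (k ! * (n ∸ k) !) ≡ n !
nCk*[k!*[n∸k]!]≡n! {n} {k} k≤n = begin
  (n C k) * (k ! * (n ∸ k) !)                    ≡⟨ cong (_* (k ! * (n ∸ k) !)) (nCk≡n!/k![n-k]! k≤n) ⟩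
  n ! / (k ! * (n ∸ k) !) * (k ! * (n ∸ k) !)    ≡⟨ m/n*n≡m (k![n∸k]!∣n! k≤n) ⟩
  n !                                            ∎
  where
  open ≡-Reasoning
  instance _ = k !* (n ∸ k) !≢0

prime∣pCk : ∀ {p k} → Prime p → 0 < k → k < p → p ∣ p C k
prime∣pCk {p@(suc n)} {k} pr 0<k k<p with euclidsLemma (p C k) (k ! * (p ∸ k) !) pr p∣pCk*k!*[p∸k]!
  where
  p∣pCk*k!*[p∸k]! : p ∣ (p C k) * (k ! * (p ∸ k) !)
  p∣pCk*k!*[p∸k]! = subst (p ∣_) (sym (nCk*[k!*[n∸k]!]≡n! (<⇒≤ k<p))) (m∣m*n (n !))
... | inj₁ p∣pCk = p∣pCk
... | inj₂ p∣k!*[p∸k]! with euclidsLemma (k !) ((p ∸ k) !) pr p∣k!*[p∸k]!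
...   | inj₁ p∣k!     = contradiction p∣k! (prime∤! pr k<p)
...   | inj₂ p∣[p∸k]! = contradiction p∣[p∸k]! (prime∤! pr (∸-monoʳ-< 0<k (<⇒≤ k<p)))

-- The library's binomial theorem is stated with the generic semiring power and multiple,
-- which agree with those of ℕ only propositionally.
module _ where
  open import Algebra.Properties.Semiring.Binomial +-*-semiring 1 1 using (theorem)
  open Semiring using () renaming (_^_ to _^ₛ_)
  open import Algebra.Definitions.RawMonoid +-0-rawMonoid using () renaming (_×_ to _·_)

  2^n≡∑nCk : ∀ n → 2 ^ n ≡ sum (λ (k : Fin (suc n)) → n C toℕ k)
  2^n≡∑nCk n = begin
    2 ^ n                                     ≡⟨ ^ₛ≡^ 2 n ⟨
    (1 + 1) ^ₛ n                              ≡⟨ theorem refl n ⟩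
    sum {suc n} (λ k → (n C toℕ k) · (1 ^ₛ toℕ k * 1 ^ₛ (n ∸ toℕ k)))
      ≡⟨ sum-cong-≗ {suc n} (λ k → term≡ (n C toℕ k) (toℕ k) (n ∸ toℕ k)) ⟩
    sum {suc n} (λ k → n C toℕ k)             ∎
    where
    open ≡-Reasoning
    ^ₛ≡^ : ∀ x n → x ^ₛ n ≡ x ^ n
    ^ₛ≡^ x zero    = refl
    ^ₛ≡^ x (suc n) = cong (x *_) (^ₛ≡^ x n)
    ·1≡ : ∀ c → c · 1 ≡ c
    ·1≡ zero    = refl
    ·1≡ (suc c) = cong suc (·1≡ c)
    term≡ : ∀ c i j → c · (1 ^ₛ i * 1 ^ₛ j) ≡ c
    term≡ c i j rewrite ^ₛ≡^ 1 i | ^ₛ≡^ 1 j | ^-zeroˡ i | ^-zeroˡ j = ·1≡ c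

∣-sum : ∀ {d n} (f : Fin n → ℕ) → (∀ i → d ∣ f i) → d ∣ sum f
∣-sum {d} {zero}  f d∣f = d ∣0
∣-sum {d} {suc n} f d∣f = ∣m∣n⇒∣m+n (d∣f zero) (∣-sum (f ∘ suc) (d∣f ∘ suc))

fermat₂ : ∀ {p} .{{_ : NonZero p}} → Prime p → 2 ^ p ≡ 2 [mod p ]
fermat₂ {p@(suc n)} pr = begin
  2 ^ p                                    ≡⟨ 2^n≡∑nCk p ⟩
  sum {suc p} (λ k → p C toℕ k)            ≡⟨ cong (1 +_) (sum-init-last {n} (λ k → p C suc (toℕ k))) ⟩
  1 + (inner + p C suc (toℕ (fromℕ n)))    ≡⟨ cong (λ k → 1 + (inner + p C suc k)) (toℕ-fromℕ n) ⟩
  1 + (inner + p C p)                      ≡⟨ cong (λ c → 1 + (inner + c)) (nCn≡1 p) ⟩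
  1 + (inner + 1)                          ≡⟨ cong suc (+-comm inner 1) ⟩
  2 + inner                                ≈⟨ mod (%-remove-+ʳ 2 (∣-sum _ p∣inner)) ⟩
  2                                        ∎
  where
  open ≡[mod]-Reasoning p
  inner = sum (λ (i : Fin n) → p C suc (toℕ (inject₁ i)))
  p∣inner : ∀ i → p ∣ p C suc (toℕ (inject₁ i))
  p∣inner i = prime∣pCk pr z<s (s<s (subst (_< n) (sym (toℕ-inject₁ i)) (toℕ<n i)))

fermat₂-odd : ∀ {n} → Prime (suc n) → 2 < suc n → 2 ^ n ≡ 1 [mod suc n ]
fermat₂-odd pr 2<p = ≡[mod]-*-cancelˡ 2 (prime⇒coprime pr 2<p) (fermat₂ pr)

module Select {P : ℕ → Set} (P? : Decidable P) where

  select : ℕ → List ℕ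
  select n = filter P? (map suc (upTo n))

  private
    select-suc : ∀ n → select (suc n) ≡ select n ++ filter P? [ suc n ]
    select-suc n = begin
      filter P? (map suc (upTo (suc n)))            ≡⟨ cong (filter P? ∘′ map suc) (upTo-∷ʳ n) ⟨
      filter P? (map suc (upTo n ++ [ n ]))         ≡⟨ cong (filter P?) (map-++ suc (upTo n) [ n ]) ⟩
      filter P? (map suc (upTo n) ++ [ suc n ])     ≡⟨ filter-++ P? (map suc (upTo n)) [ suc n ] ⟩
      select n ++ filter P? [ suc n ]               ∎
      where open ≡-Reasoning

  select-accept : ∀ n → P (suc n) → select (suc n) ≡ select n ++ [ suc n ]
  select-accept n P[1+n] = trans (select-suc n) (cong (select n ++_) (filter-accept P? P[1+n]))

  select-reject : ∀ n → ¬ P (suc n) → select (suc n) ≡ select n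
  select-reject n ¬P[1+n] = trans (select-suc n) (trans (cong (select n ++_) (filter-reject P? ¬P[1+n])) (++-identityʳ (select n)))

  select-gap : ∀ m i → (∀ d → m < d → d ≤ m + i → ¬ P d) → select (m + i) ≡ select m
  select-gap m zero    _   = cong select (+-identityʳ m)
  select-gap m (suc i) gap = begin
    select (m + suc i)   ≡⟨ cong select (+-suc m i) ⟩
    select (suc (m + i)) ≡⟨ select-reject (m + i) (gap (suc (m + i)) (s≤s (m≤m+n m i)) (≤-reflexive (sym (+-suc m i)))) ⟩
    select (m + i)       ≡⟨ select-gap m i (λ d m<d d≤m+i → gap d m<d (≤-trans d≤m+i (+-monoʳ-≤ m (n≤1+n i)))) ⟩
    select m             ∎
    where open ≡-Reasoning

  length-select-alternating : ∀ c j → (∀ i → c ≤ i → i < c + j → P (suc (2 * i)) × ¬ P (suc (suc (2 * i)))) →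
                              length (select (2 * (c + j))) ≡ length (select (2 * c)) + j
  length-select-alternating c zero    _   = trans (cong (λ n → length (select (2 * n))) (+-identityʳ c)) (sym (+-identityʳ _))
  length-select-alternating c (suc j) alt = begin
    length (select (2 * (c + suc j)))                ≡⟨ cong (λ n → length (select n)) (2*[c+1+j]≡2+2*[c+j]) ⟩
    length (select (suc (suc (2 * (c + j)))))        ≡⟨ cong length (select-reject _ (proj₂ last)) ⟩
    length (select (suc (2 * (c + j))))              ≡⟨ cong length (select-accept _ (proj₁ last)) ⟩
    length (select (2 * (c + j)) ++ [ _ ])           ≡⟨ length-++ (select (2 * (c + j))) ⟩
    length (select (2 * (c + j))) + 1                ≡⟨ cong (_+ 1) (length-select-alternating c j alt′) ⟩
    length (select (2 * c)) + j + 1                  ≡⟨ +-assoc _ j 1 ⟩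
    length (select (2 * c)) + (j + 1)                ≡⟨ cong (length (select (2 * c)) +_) (+-comm j 1) ⟩
    length (select (2 * c)) + suc j                  ∎
    where
    open ≡-Reasoning
    2*[c+1+j]≡2+2*[c+j] : 2 * (c + suc j) ≡ suc (suc (2 * (c + j)))
    2*[c+1+j]≡2+2*[c+j] = trans (cong (2 *_) (+-suc c j)) (*-suc 2 (c + j))
    last : P (suc (2 * (c + j))) × ¬ P (suc (suc (2 * (c + j))))
    last = alt (c + j) (m≤m+n c j) (≤-reflexive (sym (+-suc c j)))
    alt′ : ∀ i → c ≤ i → i < c + j → P (suc (2 * i)) × ¬ P (suc (suc (2 * i)))
    alt′ i c≤i i<c+j = alt i c≤i (subst (i <_) (sym (+-suc c j)) (m<n⇒m<1+n i<c+j))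

module _ {p} (pr : Prime p) where

  divisors-2p : 2 < p → divisors (2 * p) ≡ 1 ∷ 2 ∷ p ∷ 2 * p ∷ []
  divisors-2p (s≤s (s≤s (s≤s {n = a} _))) = begin
    select (2 * p)                                    ≡⟨ cong select 2p≡1+p+[2+a] ⟩
    select (suc (p + (2 + a)))                        ≡⟨ select-accept _ (subst (_∣ 2 * p) 2p≡1+p+[2+a] ∣-refl) ⟩
    select (p + (2 + a)) ++ [ suc (p + (2 + a)) ]     ≡⟨ cong₂ _++_ (select-gap p (2 + a) no-divisor-in-]p,2p[) (cong [_] (sym 2p≡1+p+[2+a])) ⟩
    select p ++ [ 2 * p ]                             ≡⟨ cong (_++ [ 2 * p ]) (select-accept (2 + a) (divides 2 refl)) ⟩
    (select (2 + a) ++ [ p ]) ++ [ 2 * p ]            ≡⟨ cong (λ ds → (ds ++ [ p ]) ++ [ 2 * p ]) (select-gap 2 a no-divisor-in-]2,p[) ⟩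
    (select 2 ++ [ p ]) ++ [ 2 * p ]                  ≡⟨ cong (λ ds → (ds ++ [ p ]) ++ [ 2 * p ]) select2≡[1,2] ⟩
    1 ∷ 2 ∷ p ∷ 2 * p ∷ []                            ∎
    where
    open ≡-Reasoning
    open Select (_∣? 2 * p)
    2p≡1+p+[2+a] : 2 * p ≡ suc (p + (2 + a))
    2p≡1+p+[2+a] = identity a
      where
      identity : ∀ a → 2 * (3 + a) ≡ suc ((3 + a) + (2 + a))
      identity = solve-∀
    no-divisor-in-]p,2p[ : ∀ d → p < d → d ≤ p + (2 + a) → ¬ d ∣ 2 * p
    no-divisor-in-]p,2p[ d p<d d≤ d∣2p = <⇒≱ p<d (*-cancelˡ-≤ 2 (m∣n∧m<n⇒2*m≤n d∣2p d<2p))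
      where
      d<2p : d < 2 * p
      d<2p = subst (d <_) (sym 2p≡1+p+[2+a]) (s≤s d≤)
    no-divisor-in-]2,p[ : ∀ d → 2 < d → d ≤ 2 + a → ¬ d ∣ 2 * p
    no-divisor-in-]2,p[ d@(suc _) 2<d d≤ d∣2p = <⇒≱ 2<d (∣⇒≤ (coprime-divisor d⊥p d∣p*2))
      where
      d⊥p : Coprime d p
      d⊥p = Coprimality.sym (prime⇒coprime pr (s≤s d≤))
      d∣p*2 : d ∣ p * 2
      d∣p*2 = subst (d ∣_) (*-comm 2 p) d∣2p
    select2≡[1,2] : select 2 ≡ 1 ∷ 2 ∷ []
    select2≡[1,2] = trans (select-accept 1 (divides p (*-comm 2 p))) (cong (_++ [ 2 ]) (select-accept 0 (1∣ _)))

  -- The numbers in [1, 2p] coprime to 2p are the odd ones other than p.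
  φ-2p : ∀ {r} → p ≡ suc (2 * r) → φ (2 * p) ≡ 2 * r
  φ-2p {r} refl = begin
    length (select (2 * p))                      ≡⟨ cong (length ∘′ select) (cong (λ x → 2 * suc (r + x)) (+-identityʳ r)) ⟩
    length (select (2 * (suc r + r)))            ≡⟨ length-select-alternating (suc r) r upper-half ⟩
    length (select (2 * suc r)) + r              ≡⟨ cong (λ n → length (select n) + r) (*-suc 2 r) ⟩
    length (select (suc (suc (2 * r)))) + r      ≡⟨ cong (λ ds → length ds + r) (select-reject _ (¬coprime-even r)) ⟩
    length (select (suc (2 * r))) + r            ≡⟨ cong (λ ds → length ds + r) (select-reject _ ¬coprime-p) ⟩
    length (select (2 * (0 + r))) + r            ≡⟨ cong (_+ r) (length-select-alternating 0 r lower-half) ⟩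
    r + r                                        ≡⟨ cong (r +_) (+-identityʳ r) ⟨
    2 * r                                        ∎
    where
    open ≡-Reasoning
    CoprimeTo2p : ℕ → Set
    CoprimeTo2p m = gcd m (2 * p) ≡ 1
    open Select (λ m → gcd m (2 * p) ≟ 1)
    ¬coprime-even : ∀ i → ¬ CoprimeTo2p (suc (suc (2 * i)))
    ¬coprime-even i gcd≡1 = contradiction (gcd≡1⇒coprime gcd≡1 (2∣2+2i , divides p (*-comm 2 p))) (λ ())
      where
      2∣2+2i : 2 ∣ suc (suc (2 * i))
      2∣2+2i = divides (suc i) (trans (sym (*-suc 2 i)) (*-comm 2 (suc i)))
    ¬coprime-p : ¬ CoprimeTo2p p
    ¬coprime-p gcd≡1 = nonTrivial⇒≢1 {{prime⇒nonTrivial pr}} (gcd≡1⇒coprime gcd≡1 (∣-refl , divides 2 refl))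
    coprime-odd : ∀ i → i ≢ r → i < p → CoprimeTo2p (suc (2 * i))
    coprime-odd i i≢r i<p = coprime⇒gcd≡1 (coprime-*ʳ (¬∣⇒coprime prime[2] (¬2∣odd i)) (¬∣⇒coprime pr p∤1+2i))
      where
      p∤1+2i : ¬ p ∣ suc (2 * i)
      p∤1+2i p∣1+2i = i≢r (*-cancelˡ-≡ i r 2 (suc-injective (m∣n∧n<2*m⇒n≡m p∣1+2i 1+2i<2p)))
        where
        1+2i<2p : suc (2 * i) < 2 * p
        1+2i<2p = ≤-trans (≤-reflexive (sym (*-suc 2 i))) (*-monoʳ-≤ 2 i<p)
    lower-half : ∀ i → 0 ≤ i → i < 0 + r → CoprimeTo2p (suc (2 * i)) × ¬ CoprimeTo2p (suc (suc (2 * i)))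
    lower-half i _ i<r = coprime-odd i (<⇒≢ i<r) (<-trans i<r (s≤s (m≤m+n r (r + 0)))) , ¬coprime-even i
    upper-half : ∀ i → suc r ≤ i → i < suc r + r → CoprimeTo2p (suc (2 * i)) × ¬ CoprimeTo2p (suc (suc (2 * i)))
    upper-half i r<i i< = coprime-odd i (>⇒≢ r<i) (subst (λ x → i < suc (r + x)) (sym (+-identityʳ r)) i<) , ¬coprime-even i

σ≡[2^k+1]*[q^k+1] : ∀ {q} → divisors (2 * q) ≡ 1 ∷ 2 ∷ q ∷ 2 * q ∷ [] → ∀ k → σ k (2 * q) ≡ (2 ^ k + 1) * (q ^ k + 1)
σ≡[2^k+1]*[q^k+1] {q} divisors≡ k = begin
  σ k (2 * q)                                       ≡⟨ cong (List.sum ∘′ map (_^ k)) divisors≡ ⟩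
  1 ^ k + (2 ^ k + (q ^ k + ((2 * q) ^ k + 0)))     ≡⟨ cong₂ (λ x y → x + (2 ^ k + (q ^ k + (y + 0)))) (^-zeroˡ k) (^-distribʳ-* 2 q k) ⟩
  1 + (2 ^ k + (q ^ k + (2 ^ k * q ^ k + 0)))       ≡⟨ identity (2 ^ k) (q ^ k) ⟩
  (2 ^ k + 1) * (q ^ k + 1)                         ∎
  where
  open ≡-Reasoning
  identity : ∀ x y → 1 + (x + (y + (x * y + 0))) ≡ (x + 1) * (y + 1)
  identity = solve-∀

14∉S-odd : ∀ h → ¬ S (suc (2 * h)) 14
14∉S-odd h (_ , 14σ≋2) = 0≢1+n (%-≡ (≡[mod]-trans (≡[mod]-sym 14σ≡0) 14σ≡2))
  where
  k = suc (2 * h)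
  14σ≡2[6] : 14 * σ k 14 ≡ 2 [mod 6 ]
  14σ≡2[6] = ≋⇒≡[mod] 14σ≋2
  14σ≡2 : 14 * σ k 14 ≡ 2 [mod 3 ]
  14σ≡2 = ≡[mod]-divisor (divides 2 refl) 14σ≡2[6]
  14σ≡0 : 14 * σ k 14 ≡ 0 [mod 3 ]
  14σ≡0 = ∣⇒≡0[mod] (subst (3 ∣_) (cong (14 *_) (sym (σ≡[2^k+1]*[q^k+1] {7} refl k)))
                        (∣n⇒∣m*n 14 (∣m⇒∣m*n (7 ^ k + 1) (m+1∣m^odd+1 2 h))))

10∉S-odd : ∀ h → ¬ S (suc (2 * h)) 10
10∉S-odd h (_ , 10σ≋2) = 0≢1+n (%-≡ (≡[mod]-trans (≡[mod]-sym 10σ≡0) 10σ≡2))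
  where
  k = suc (2 * h)
  10σ≡2 : 10 * σ k 10 ≡ 2 [mod 4 ]
  10σ≡2 = ≋⇒≡[mod] 10σ≋2
  2∣10 : 2 ∣ 10
  2∣10 = divides 5 refl
  2∣[2^k+1][5^k+1] : 2 ∣ (2 ^ k + 1) * (5 ^ k + 1)
  2∣[2^k+1][5^k+1] = ∣n⇒∣m*n (2 ^ k + 1) (∣-trans (divides 3 refl) (m+1∣m^odd+1 5 h))
  10σ≡0 : 10 * σ k 10 ≡ 0 [mod 4 ]
  10σ≡0 = ∣⇒≡0[mod] (subst (4 ∣_) (cong (10 *_) (sym (σ≡[2^k+1]*[q^k+1] {5} refl k))) (*-pres-∣ 2∣10 2∣[2^k+1][5^k+1]))

2p∈S⇒r∣2^[k+1]+1 : ∀ {p r k} → Prime p → p ≡ suc (2 * r) → Prime r → 2 < r → S k (2 * p) → r ∣ 2 ^ suc k + 1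
2p∈S⇒r∣2^[k+1]+1 {p} {r} {k} pr p≡1+2r r-prime 2<r (_ , 2pσ≋2) =
  ≡0[mod]⇒∣ (≡[mod]-+-cancelʳ 1 (≡[mod]-*-cancelˡ 2 (prime⇒coprime r-prime 2<r) 2[2^[k+1]+1+1]≡2))
  where
  instance
    r≢0 : NonZero r
    r≢0 = prime⇒nonZero r-prime
    2r≢0 : NonZero (2 * r)
    2r≢0 = m*n≢0 2 r
  2pσ≡2 : 2 * p * σ k (2 * p) ≡ 2 [mod r ]
  2pσ≡2 = ≡[mod]-divisor (n∣m*n 2 {r}) (≋⇒≡[mod] 2pσ≋2[mod2r])
    where
    2pσ≋2[mod2r] : 2 * p * σ k (2 * p) ≋ 2 [mod 2 * r ]
    2pσ≋2[mod2r] = subst (λ m → 2 * p * σ k (2 * p) ≋ 2 [mod m ]) (φ-2p pr {r} p≡1+2r) 2pσ≋2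
  p≡1 : p ≡ 1 [mod r ]
  p≡1 = mod (trans (cong (_% r) p≡1+2r) ([m+kn]%n≡m%n 1 2 r))
  2[2^[k+1]+1+1]≡2 : 2 * (2 ^ suc k + 1 + 1) ≡ 2 * 1 [mod r ]
  2[2^[k+1]+1+1]≡2 = begin
    2 * (2 ^ suc k + 1 + 1)                  ≡⟨ identity (2 ^ k) ⟩
    2 * 1 * ((2 ^ k + 1) * (1 + 1))
      ≈⟨ ≡[mod]-* (≡[mod]-*-congˡ 2 p≡1) (≡[mod]-*-congˡ (2 ^ k + 1) (≡[mod]-+-congʳ 1 p^k≡1)) ⟨
    2 * p * ((2 ^ k + 1) * (p ^ k + 1))      ≡⟨ cong (2 * p *_) (σ≡[2^k+1]*[q^k+1] (divisors-2p pr 2<p) k) ⟨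
    2 * p * σ k (2 * p)                      ≈⟨ 2pσ≡2 ⟩
    2                                        ∎
    where
    open ≡[mod]-Reasoning r
    2<p : 2 < p
    2<p = subst (2 <_) (sym p≡1+2r) (<-trans 2<r (s≤s (m≤m+n r (r + 0))))
    p^k≡1 : p ^ k ≡ 1 [mod r ]
    p^k≡1 = subst (λ x → p ^ k ≡ x [mod r ]) (^-zeroˡ k) (≡[mod]-^ p≡1 k)
    identity : ∀ x → 2 * (2 * x + 1 + 1) ≡ 2 * 1 * ((x + 1) * (1 + 1))
    identity = solve-∀

prime≡3+4q∤2^2m+1 : ∀ q m → Prime (3 + 4 * q) → ¬ 3 + 4 * q ∣ 2 ^ (2 * m) + 1
prime≡3+4q∤2^2m+1 q m pr r∣y+1 = <⇒≱ 2<r (∣⇒≤ (≡0[mod]⇒∣ 2≡0))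
  where
  r = 3 + 4 * q
  y = 2 ^ (2 * m)
  2<r : 2 < r
  2<r = s≤s (s≤s (s≤s z≤n))
  y^[1+2q]+1≡0 : y ^ suc (2 * q) + 1 ≡ 0 [mod r ]
  y^[1+2q]+1≡0 = ∣⇒≡0[mod] (∣-trans r∣y+1 (m+1∣m^odd+1 y q))
  y^[1+2q]≡1 : y ^ suc (2 * q) ≡ 1 [mod r ]
  y^[1+2q]≡1 = begin
    y ^ suc (2 * q)               ≡⟨ ^-*-assoc 2 (2 * m) (suc (2 * q)) ⟩
    2 ^ (2 * m * suc (2 * q))     ≡⟨ cong (2 ^_) (identity m q) ⟩
    2 ^ ((2 + 4 * q) * m)         ≡⟨ ^-*-assoc 2 (2 + 4 * q) m ⟨
    (2 ^ (2 + 4 * q)) ^ m         ≈⟨ ≡[mod]-^ (fermat₂-odd pr 2<r) m ⟩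
    1 ^ m                         ≡⟨ ^-zeroˡ m ⟩
    1                             ∎
    where
    open ≡[mod]-Reasoning r
    identity : ∀ m q → 2 * m * suc (2 * q) ≡ (2 + 4 * q) * m
    identity = solve-∀
  2≡0 : 2 ≡ 0 [mod r ]
  2≡0 = ≡[mod]-trans (≡[mod]-sym (≡[mod]-+-congʳ 1 y^[1+2q]≡1)) y^[1+2q]+1≡0

corollary4p3 : (p r : ℕ) → Prime p → p ≢ 2 → p ≡ 2 * r + 1 → Prime r →
    NontriviallyFlanks14 (2 * p) → p % 8 ≡ 3
-- The hypothesis p ≢ 2 is unused: it is implied by p ≡ 2 * r + 1.
corollary4p3 p r p-prime _ p≡2r+1 r-prime (k , _ , 2p∈Sₖ , _ , 14∈Sₖ₊₁) with even⊎odd k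
... | inj₁ (h , refl) = ⊥-elim (14∉S-odd h 14∈Sₖ₊₁)
... | inj₂ (h , refl) with prime⇒≡2⊎≡1+4q⊎≡3+4q r-prime
...   | inj₁ refl = ⊥-elim (10∉S-odd h (subst (λ q → S (suc (2 * h)) (2 * q)) p≡2r+1 2p∈Sₖ))
...   | inj₂ (inj₁ (q , refl)) = trans (cong (_% 8) (trans p≡2r+1 (identity q))) ([m+kn]%n≡m%n 3 q 8)
  where
  identity : ∀ q → 2 * (1 + 4 * q) + 1 ≡ 3 + q * 8
  identity = solve-∀
...   | inj₂ (inj₂ (q , refl)) = ⊥-elim (prime≡3+4q∤2^2m+1 q (suc h) r-prime r∣2^[2+2h]+1)
  where
  r∣2^[2+2h]+1 : 3 + 4 * q ∣ 2 ^ (2 * suc h) + 1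
  r∣2^[2+2h]+1 = subst (λ e → 3 + 4 * q ∣ 2 ^ e + 1) (sym (*-suc 2 h))
    (2p∈S⇒r∣2^[k+1]+1 {k = suc (2 * h)} p-prime p≡1+2r r-prime (s≤s (s≤s (s≤s z≤n))) 2p∈Sₖ)
    where
    p≡1+2r : p ≡ suc (2 * (3 + 4 * q))
    p≡1+2r = trans p≡2r+1 (+-comm (2 * (3 + 4 * q)) 1)
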